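{- For every integer $k\ge1$, the set $D$ (OEIS A036991) contains an arithmetic progression of length $k$: there exist integers $a\ge0$ and $d>0$ such that $a, a+d, a+2d,\dots,a+(k-1)d$ all belong to $D$.
   Context: $D$ (OEIS A036991, the "Dyck numbers") is the set consisting of $0$ together with all positive integers $n$ whose binary representation (without leading zeros) has the property that every suffix contains at least as many digits $1$ as digits $0$. -}

module Defs where

open import Data.Nat using (ℕ; zero; suc; _≤_; _≡ᵇ_)
open import Data.Nat.DivMod using (_/_; _%_)
open import Data.Bool using (Bool; true; false)
open import Data.List using (List; []; _∷_; _∷ʳ_; length; filter; tails)
open import Data.List.Relation.Unary.All using (All)
open import Relation.Binary.PropositionalEquality using (_≡_)
open import Data.Sum using (_⊎_)
open import Data.Product using (_×_)

-- binary digits, least significant first, with fuel to ensure termination;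
-- with fuel ≥ n this yields the representation of n without leading zeros
-- (empty list for 0).
bitsLSB : ℕ → ℕ → List Bool
bitsLSB zero    _       = []
bitsLSB (suc f) zero    = []
bitsLSB (suc f) (suc m) = ((suc m % 2) ≡ᵇ 1) ∷ bitsLSB f (suc m / 2)

reverseL : List Bool → List Bool
reverseL []       = []
reverseL (b ∷ bs) = reverseL bs ∷ʳ b

binary : ℕ → List Bool
binary n = reverseL (bitsLSB n n)

ones zeros : List Bool → ℕ
ones []           = 0
ones (true ∷ bs)  = suc (ones bs)
ones (false ∷ bs) = ones bs
zeros []           = 0
zeros (true ∷ bs)  = zeros bs
zeros (false ∷ bs) = suc (zeros bs)

Balanced : List Bool → Set
Balanced bs = All (λ s → zeros s ≤ ones s) (tails bs)

InD : ℕ → Set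
InD n = n ≡ 0 ⊎ (1 ≤ n × Balanced (binary n))

-- Appending L ones to the binary representation of m gives 2^L·m + 2^L − 1,
-- which is affine in m with difference 2^L. The appended block of ones
-- outweighs every suffix of the at most m leading digits, so for m = 0, 1, …, L
-- these numbers are Dyck numbers: an arithmetic progression of
-- length L + 1 in D.
module Submission where

open import Defs
open import Data.Nat using (ℕ; zero; suc; _+_; _*_; _≤_; _<_; _^_; z≤n; s≤s; _≡ᵇ_)
open import Data.Nat.Properties
open import Data.Nat.DivMod using (_/_; [m+kn]%n≡m%n; +-distrib-/-∣ʳ; m*n/n≡m; m/n<m)
open import Data.Nat.Divisibility using (divides-refl)
open import Data.Bool using (true; false)
open import Data.List using (List; []; _∷_; _∷ʳ_; _++_; length; replicate; reverse)
open import Data.List.Properties using (unfold-reverse; reverse-++; length-reverse)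
open import Data.List.Relation.Unary.All using (_∷_; [])
open import Data.Product using (Σ; ∃; _×_; _,_)
open import Data.Sum using (inj₂)
open import Relation.Binary.PropositionalEquality

appendOnes : ℕ → ℕ → ℕ
appendOnes zero    m = m
appendOnes (suc L) m = suc (appendOnes L m * 2)

appendOnes-affine : ∀ L m → appendOnes L m ≡ appendOnes L 0 + m * 2 ^ L
appendOnes-affine zero    m = sym (*-identityʳ m)
appendOnes-affine (suc L) m = cong suc (begin
  appendOnes L m * 2                  ≡⟨ cong (_* 2) (appendOnes-affine L m) ⟩
  (appendOnes L 0 + m * 2 ^ L) * 2    ≡⟨ *-distribʳ-+ 2 (appendOnes L 0) (m * 2 ^ L) ⟩
  appendOnes L 0 * 2 + m * 2 ^ L * 2  ≡⟨ cong (appendOnes L 0 * 2 +_) (*-assoc m (2 ^ L) 2) ⟩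
  appendOnes L 0 * 2 + m * (2 ^ L * 2) ≡⟨ cong (λ e → appendOnes L 0 * 2 + m * e) (*-comm (2 ^ L) 2) ⟩
  appendOnes L 0 * 2 + m * 2 ^ suc L  ∎)
  where open ≡-Reasoning

bitsLSB-1+m*2 : ∀ f m → bitsLSB (suc f) (suc (m * 2)) ≡ true ∷ bitsLSB f m
bitsLSB-1+m*2 f m = cong₂ (λ b n → b ∷ bitsLSB f n)
  (cong (_≡ᵇ 1) ([m+kn]%n≡m%n 1 m 2))
  (trans (+-distrib-/-∣ʳ 1 {d = 2} (divides-refl m)) (m*n/n≡m m 2))

bitsLSB-appendOnes : ∀ L m f → appendOnes L m ≤ f →
                     ∃ λ f′ → bitsLSB f (appendOnes L m) ≡ replicate L true ++ bitsLSB f′ m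
bitsLSB-appendOnes zero    m f       _         = f , refl
bitsLSB-appendOnes (suc L) m (suc f) (s≤s ≤f) with bitsLSB-appendOnes L m f (≤-trans (m≤m*n _ 2) ≤f)
... | f′ , eq = f′ , trans (bitsLSB-1+m*2 f (appendOnes L m)) (cong (true ∷_) eq)

length-bitsLSB≤ : ∀ f m → length (bitsLSB f m) ≤ m
length-bitsLSB≤ zero    m       = z≤n
length-bitsLSB≤ (suc f) zero    = z≤n
length-bitsLSB≤ (suc f) (suc m) =
  s≤s (≤-trans (length-bitsLSB≤ f (suc m / 2)) (≤-pred (m/n<m (suc m) 2 (s≤s (s≤s z≤n)))))

reverseL≡reverse : ∀ bs → reverseL bs ≡ reverse bs
reverseL≡reverse []       = refl
reverseL≡reverse (b ∷ bs) = trans (cong (_∷ʳ b) (reverseL≡reverse bs)) (sym (unfold-reverse b bs))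

replicate-∷ʳ : ∀ {A : Set} n (x : A) → replicate n x ∷ʳ x ≡ x ∷ replicate n x
replicate-∷ʳ zero    x = refl
replicate-∷ʳ (suc n) x = cong (x ∷_) (replicate-∷ʳ n x)

reverse-replicate : ∀ {A : Set} n (x : A) → reverse (replicate n x) ≡ replicate n x
reverse-replicate zero    x = refl
reverse-replicate (suc n) x = begin
  reverse (x ∷ replicate n x)   ≡⟨ unfold-reverse x (replicate n x) ⟩
  reverse (replicate n x) ∷ʳ x  ≡⟨ cong (_∷ʳ x) (reverse-replicate n x) ⟩
  replicate n x ∷ʳ x            ≡⟨ replicate-∷ʳ n x ⟩
  x ∷ replicate n x             ∎
  where open ≡-Reasoning

binary-appendOnes : ∀ L m → ∃ λ f → binary (appendOnes L m) ≡ reverse (bitsLSB f m) ++ replicate L true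
binary-appendOnes L m with bitsLSB-appendOnes L m (appendOnes L m) ≤-refl
... | f , eq = f , (begin
  reverseL (bitsLSB (appendOnes L m) (appendOnes L m))   ≡⟨ reverseL≡reverse (bitsLSB (appendOnes L m) (appendOnes L m)) ⟩
  reverse (bitsLSB (appendOnes L m) (appendOnes L m))    ≡⟨ cong reverse eq ⟩
  reverse (replicate L true ++ bitsLSB f m)              ≡⟨ reverse-++ (replicate L true) (bitsLSB f m) ⟩
  reverse (bitsLSB f m) ++ reverse (replicate L true)    ≡⟨ cong (reverse (bitsLSB f m) ++_) (reverse-replicate L true) ⟩
  reverse (bitsLSB f m) ++ replicate L true              ∎)
  where open ≡-Reasoning

zeros≤length : ∀ bs → zeros bs ≤ length bs
zeros≤length []           = z≤n
zeros≤length (true ∷ bs)  = m≤n⇒m≤1+n (zeros≤length bs)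
zeros≤length (false ∷ bs) = s≤s (zeros≤length bs)

zeros-++ : ∀ xs ys → zeros (xs ++ ys) ≡ zeros xs + zeros ys
zeros-++ []           ys = refl
zeros-++ (true ∷ xs)  ys = zeros-++ xs ys
zeros-++ (false ∷ xs) ys = cong suc (zeros-++ xs ys)

ones-++ : ∀ xs ys → ones (xs ++ ys) ≡ ones xs + ones ys
ones-++ []           ys = refl
ones-++ (true ∷ xs)  ys = cong suc (ones-++ xs ys)
ones-++ (false ∷ xs) ys = ones-++ xs ys

zeros-replicate-true : ∀ L → zeros (replicate L true) ≡ 0
zeros-replicate-true zero    = refl
zeros-replicate-true (suc L) = zeros-replicate-true L

ones-replicate-true : ∀ L → ones (replicate L true) ≡ L
ones-replicate-true zero    = refl
ones-replicate-true (suc L) = cong suc (ones-replicate-true L)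

zeros≤ones-++-trues : ∀ xs L → length xs ≤ L → zeros (xs ++ replicate L true) ≤ ones (xs ++ replicate L true)
zeros≤ones-++-trues xs L ≤L = begin
  zeros (xs ++ replicate L true)           ≡⟨ zeros-++ xs (replicate L true) ⟩
  zeros xs + zeros (replicate L true)      ≡⟨ cong (zeros xs +_) (zeros-replicate-true L) ⟩
  zeros xs + 0                             ≡⟨ +-identityʳ (zeros xs) ⟩
  zeros xs                                 ≤⟨ zeros≤length xs ⟩
  length xs                                ≤⟨ ≤L ⟩
  L                                        ≤⟨ m≤n+m L (ones xs) ⟩
  ones xs + L                              ≡⟨ cong (ones xs +_) (ones-replicate-true L) ⟨
  ones xs + ones (replicate L true)        ≡⟨ ones-++ xs (replicate L true) ⟨
  ones (xs ++ replicate L true)            ∎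
  where open ≤-Reasoning

Balanced-++-trues : ∀ xs L → length xs ≤ L → Balanced (xs ++ replicate L true)
Balanced-++-trues []       zero    _  = z≤n ∷ []
Balanced-++-trues []       (suc L) _  = zeros≤ones-++-trues [] (suc L) z≤n ∷ Balanced-++-trues [] L z≤n
Balanced-++-trues (x ∷ xs) L       ≤L = zeros≤ones-++-trues (x ∷ xs) L ≤L
                                       ∷ Balanced-++-trues xs L (≤-trans (n≤1+n _) ≤L)

Balanced-binary-appendOnes : ∀ L {m} → m ≤ L → Balanced (binary (appendOnes L m))
Balanced-binary-appendOnes L {m} m≤L with binary-appendOnes L m
... | f , eq = subst Balanced (sym eq) (Balanced-++-trues (reverse (bitsLSB f m)) L length≤L)
  where
  length≤L : length (reverse (bitsLSB f m)) ≤ L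
  length≤L = ≤-trans (≤-reflexive (length-reverse (bitsLSB f m))) (≤-trans (length-bitsLSB≤ f m) m≤L)

theorem7 : (k : ℕ) → 1 ≤ k →
    Σ ℕ (λ a → Σ ℕ (λ d → 0 < d × ((i : ℕ) → i < k → InD (a + i * d))))
theorem7 k@(suc _) _ = appendOnes k 0 , 2 ^ k , m^n>0 2 k , λ i i<k →
  subst InD (appendOnes-affine k i) (inj₂ (s≤s z≤n , Balanced-binary-appendOnes k (<⇒≤ i<k)))
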